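{- Let $\$=\langle 1,c_2,c_3,c_4\rangle$ be a coin system, i.e. natural numbers $1<c_2<c_3<c_4$. Then $\$$ is non-canonical if and only if at least one of the following conditions holds: (1) the coin system $\langle 1,c_2,c_3\rangle$ is non-canonical; (2) there is a natural number $k$ with $k\cdot c_3<c_4<(k+1)\cdot c_3$ and $|\mathrm{GRD}_{\$}((k+1)\cdot c_3)|>k+1$.
   Context: A coin system is a tuple $\$=\langle c_1,c_2,\dots,c_m\rangle$ of natural numbers with $1=c_1<c_2<\cdots<c_m$. A representation of a natural number $x$ under $\$$ is a tuple $(\alpha_1,\dots,\alpha_m)$ of natural numbers with $\sum_i \alpha_i c_i=x$; its size is $\sum_i\alpha_i$. The greedy representation $\mathrm{GRD}_{\$}(x)$ is the unique representation satisfying $\sum_{j=1}^{i-1}\alpha_jc_j<c_i$ for all $2\le i\le m$ (obtained by repeatedly taking the largest coin not exceeding the remaining amount), and $|\mathrm{GRD}_{\$}(x)|$ is its size. $\mathrm{OPT}_{\$}(x)$ denotes a representation of $x$ of minimum size, with size $|\mathrm{OPT}_{\$}(x)|$. The system $\$$ is canonical if $|\mathrm{GRD}_{\$}(x)|=|\mathrm{OPT}_{\$}(x)|$ for all natural numbers $x$; otherwise it is non-canonical, and any $x$ with $|\mathrm{GRD}_{\$}(x)|>|\mathrm{OPT}_{\$}(x)|$ is called a counterexample of $\$$. -}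

module Defs where

open import Data.Nat using (ℕ; zero; suc; _+_; _*_; _<_; _/_; _%_)
open import Data.List using (List; []; _∷_; zipWith; length; reverse)
open import Data.Nat.ListAction using (sum)
open import Data.Product using (Σ; _×_; ∃-syntax)
open import Relation.Binary.PropositionalEquality using (_≡_)

-- A coin system is a list of coin values ⟨c₁,…,cₘ⟩ in increasing order
-- (we only use concrete lists [ 1 , c₂ , … ] with explicit hypotheses).

IsRepresentation : List ℕ → List ℕ → ℕ → Set
IsRepresentation cs α x = (length α ≡ length cs) × (sum (zipWith _*_ α cs) ≡ x)

size : List ℕ → ℕ
size α = sum α

-- Greedy algorithm on coins given in DECREASING order: take as many of the
-- largest coin as possible, continue with the remainder.
-- (A coin of value 0 never occurs in a coin system; it is skipped.)
greedyDesc : List ℕ → ℕ → List ℕ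
greedyDesc [] x = []
greedyDesc (zero ∷ ds) x = 0 ∷ greedyDesc ds x
greedyDesc (suc d ∷ ds) x = (x / suc d) ∷ greedyDesc ds (x % suc d)

GRD : List ℕ → ℕ → List ℕ
GRD cs x = reverse (greedyDesc (reverse cs) x)

Counterexample : List ℕ → ℕ → Set
Counterexample cs x = Σ (List ℕ) λ α → IsRepresentation cs α x × (size α < size (GRD cs x))

NonCanonical : List ℕ → Set
NonCanonical cs = ∃[ x ] Counterexample cs x

-- The one-point theorem of Magazine, Nemhauser and Trotter, applied twice. Let S be canonical
-- with largest coin b, and add a coin c ≥ b, written c = q·b − r with 0 ≤ r < b. If
-- |GRD_S(r)| < q, greedy sizes in the extension never exceed those in S, so it is canonical:
-- for x ≥ c, either the greedy S-representation of x has at least q coins b, and x − c arises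
-- by trading q·b for r, which saves q − 1 − |GRD_S(r)| ≥ 0 coins (induction on x), or it has
-- fewer, and then x − c < b.
-- Otherwise (k+1)·b, for k = ⌊c/b⌋, is a counterexample; this is condition (2) for c over
-- ⟨1,a,b⟩, and the same dichotomy for b over the canonical ⟨1,a⟩ decides condition (1).
-- Conversely, if ⟨1,a,b⟩ has the counterexample x₀ = (k+1)·a, it stays one unless c ≤ x₀ < a + b,
-- and then a + b is a counterexample, or 2b is when c = a + b − 1.
module Submission where

open import Defs
open import Data.Nat using (ℕ; zero; suc; z<s; _+_; _*_; _∸_; _/_; _%_; _≤_; _<_; z≤n; s≤s; _≤?_; _<?_; NonZero)
open import Data.Nat.Properties
open import Data.Nat.DivMod
open import Data.Nat.Induction using (<-rec)
open import Data.Nat.Tactic.RingSolver using (solve-∀)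
open import Data.List using ([]; _∷_)
open import Data.Product using (∃; ∃₂; ∃-syntax; _×_; _,_)
open import Data.Sum using (_⊎_; inj₁; inj₂)
open import Data.Empty using (⊥-elim)
open import Function.Base using (_∘′_)
open import Function.Bundles using (_⇔_; mk⇔)
open import Relation.Nullary using (¬_; yes; no)
open import Relation.Binary.PropositionalEquality

m/n+m%n≤1⇒m≡n : ∀ m n .{{_ : NonZero n}} → 2 ≤ m → m / n + m % n ≤ 1 → m ≡ n
m/n+m%n≤1⇒m≡n m n 2≤m sum≤1 with m / n | m % n | m≡m%n+[m/n]*n m n
... | zero          | r      | m≡r+0 = ⊥-elim (<⇒≱ 2≤m (subst (_≤ 1) (sym (trans m≡r+0 (+-identityʳ r))) sum≤1))
... | suc zero      | zero   | m≡n+0 = trans m≡n+0 (+-identityʳ n)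
... | suc zero      | suc _  | _     with s≤s () ← sum≤1
... | suc (suc _)   | _      | _     with s≤s () ← sum≤1

-- A coin system as seen by the greedy algorithm: Rep x n says that x is a sum of n coins,
-- grd x is the size of the greedy representation, and the largest coin is suc pred-top.
record CoinSystem : Set₁ where
  field
    Rep      : ℕ → ℕ → Set
    grd      : ℕ → ℕ
    pred-top : ℕ

  top : ℕ
  top = suc pred-top

  field
    rep-grd : ∀ x → Rep x (grd x)
    rep-0   : Rep 0 0
    rep-top : Rep top 1
    rep-+   : ∀ {x m y n} → Rep x m → Rep y n → Rep (x + y) (m + n)
    grd-0   : grd 0 ≡ 0
    grd-top : ∀ x → grd x ≡ x / top + grd (x % top)

open CoinSystem public

Canonical : CoinSystem → Set
Canonical S = ∀ {x n} → Rep S x n → grd S x ≤ n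

module _ (S : CoinSystem) where

  grd-+top : ∀ x → grd S (x + top S) ≡ suc (grd S x)
  grd-+top x = begin
    grd S (x + t)                      ≡⟨ grd-top S (x + t) ⟩
    (x + t) / t + grd S ((x + t) % t)  ≡⟨ cong₂ _+_ [x+t]/t≡1+x/t (cong (grd S) ([m+n]%n≡m%n x t)) ⟩
    suc (x / t + grd S (x % t))        ≡⟨ cong suc (grd-top S x) ⟨
    suc (grd S x)                      ∎
    where
    open ≡-Reasoning
    t = top S
    [x+t]/t≡1+x/t : (x + t) / t ≡ suc (x / t)
    [x+t]/t≡1+x/t = trans (m/n≡1+[m∸n]/n (m≤n+m t x)) (cong (λ u → suc (u / t)) (m+n∸n≡m x t))

  grd-+*top : ∀ y z → grd S (y + z * top S) ≡ z + grd S y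
  grd-+*top y zero    = cong (grd S) (+-identityʳ y)
  grd-+*top y (suc z) = begin
    grd S (y + (t + z * t))  ≡⟨ cong (grd S) (trans (cong (y +_) (+-comm t (z * t))) (sym (+-assoc y (z * t) t))) ⟩
    grd S (y + z * t + t)    ≡⟨ grd-+top (y + z * t) ⟩
    suc (grd S (y + z * t))  ≡⟨ cong suc (grd-+*top y z) ⟩
    suc (z + grd S y)        ∎
    where
    open ≡-Reasoning
    t = top S

  rep-*top : ∀ z → Rep S (z * top S) z
  rep-*top zero    = rep-0 S
  rep-*top (suc z) = rep-+ S (rep-top S) (rep-*top z)

⟨1⟩ : CoinSystem
⟨1⟩ = record
  { Rep      = _≡_
  ; grd      = λ x → x
  ; pred-top = 0
  ; rep-grd  = λ _ → refl
  ; rep-0    = refl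
  ; rep-top  = refl
  ; rep-+    = cong₂ _+_
  ; grd-0    = refl
  ; grd-top  = λ x → sym (trans (cong₂ _+_ (n/1≡n x) (n%1≡0 x)) (+-identityʳ x))
  }

⟨1⟩-canonical : Canonical ⟨1⟩
⟨1⟩-canonical = ≤-reflexive

data ExtRep (S : CoinSystem) (c : ℕ) : ℕ → ℕ → Set where
  _⊕_ : ∀ {y m} → Rep S y m → (z : ℕ) → ExtRep S c (y + z * c) (m + z)

module _ {S : CoinSystem} {c : ℕ} where

  extRep-+ : ∀ {x m y n} → ExtRep S c x m → ExtRep S c y n → ExtRep S c (x + y) (m + n)
  extRep-+ (_⊕_ {y₁} {m₁} r₁ z₁) (_⊕_ {y₂} {m₂} r₂ z₂) =
    subst₂ (ExtRep S c) (amounts y₁ y₂ z₁ z₂ c) (sizes m₁ m₂ z₁ z₂) (rep-+ S r₁ r₂ ⊕ (z₁ + z₂))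
    where
    amounts : ∀ y₁ y₂ z₁ z₂ c → (y₁ + y₂) + (z₁ + z₂) * c ≡ (y₁ + z₁ * c) + (y₂ + z₂ * c)
    amounts = solve-∀
    sizes : ∀ m₁ m₂ z₁ z₂ → (m₁ + m₂) + (z₁ + z₂) ≡ (m₁ + z₁) + (m₂ + z₂)
    sizes = solve-∀

extend : CoinSystem → ℕ → CoinSystem
extend S c-1 = record
  { Rep      = ExtRep S c
  ; grd      = λ x → x / c + grd S (x % c)
  ; pred-top = c-1
  ; rep-grd  = λ x → subst₂ (ExtRep S c) (sym (m≡m%n+[m/n]*n x c)) (+-comm (grd S (x % c)) (x / c))
                              (rep-grd S (x % c) ⊕ (x / c))
  ; rep-0    = rep-0 S ⊕ 0
  ; rep-top  = subst (λ y → ExtRep S c y 1) (+-identityʳ c) (rep-0 S ⊕ 1)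
  ; rep-+    = extRep-+
  ; grd-0    = grd-0 S
  ; grd-top  = λ x → cong (x / c +_) (sym (cong₂ _+_ (m<n⇒m/n≡0 (m%n<n x c)) (cong (grd S) (m%n%n≡m%n x c))))
  }
  where c = suc c-1

grd-extend-below : ∀ S c-1 {x} → x < suc c-1 → grd (extend S c-1) x ≡ grd S x
grd-extend-below S c-1 x<c = cong₂ _+_ (m<n⇒m/n≡0 x<c) (cong (grd S) (m<n⇒m%n≡m x<c))

MNTCondition : CoinSystem → ℕ → Set
MNTCondition S c-1 = ∃₂ λ q r → (suc c-1 + r ≡ q * top S) × (r < top S) × (grd S r < q)

module OnePoint (S : CoinSystem) (c-1 : ℕ) (top≤c : top S ≤ suc c-1) (canonical : Canonical S)
                (q r : ℕ) (c+r≡q*b : suc c-1 + r ≡ q * top S) (r<b : r < top S) (grd-r<q : grd S r < q) where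

  private
    b  = top S
    c  = suc c-1
    S⁺ = extend S c-1

  module _ (s : ℕ) where
    private
      x  = s + c
      w  = x / b
      y₀ = x % b

      grd-x : grd S x ≡ w + grd S y₀
      grd-x = grd-top S x

      x≡y₀+w*b : x ≡ y₀ + w * b
      x≡y₀+w*b = m≡m%n+[m/n]*n x b

    grd⁺≤grd-many-top : q ≤ w → grd S⁺ s ≤ grd S s → grd S⁺ x ≤ grd S x
    grd⁺≤grd-many-top q≤w ih = begin
      grd S⁺ (s + c)                ≡⟨ grd-+top S⁺ s ⟩
      suc (grd S⁺ s)                ≤⟨ s≤s ih ⟩
      suc (grd S s)                 ≡⟨ cong (suc ∘′ grd S) s≡v ⟩
      suc (grd S v)                 ≤⟨ s≤s (canonical (rep-+ S (rep-grd S r) (rep-+ S (rep-*top S d) (rep-grd S y₀)))) ⟩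
      suc (grd S r + (d + grd S y₀)) ≡⟨ cong suc (+-assoc (grd S r) d (grd S y₀)) ⟨
      suc (grd S r) + d + grd S y₀  ≤⟨ +-monoˡ-≤ (grd S y₀) (+-monoˡ-≤ d grd-r<q) ⟩
      q + d + grd S y₀              ≡⟨ cong (_+ grd S y₀) (m+[n∸m]≡n q≤w) ⟩
      w + grd S y₀                  ≡⟨ grd-x ⟨
      grd S x                       ∎
      where
      open ≤-Reasoning
      d = w ∸ q
      v = r + (d * b + y₀)
      shuffle : ∀ r d b y₀ c → r + (d * b + y₀) + c ≡ y₀ + ((c + r) + d * b)
      shuffle = solve-∀
      s≡v : s ≡ v
      s≡v = +-cancelʳ-≡ c s v (begin-equality
        s + c                       ≡⟨ x≡y₀+w*b ⟩
        y₀ + w * b                  ≡⟨ cong (λ n → y₀ + n * b) (m+[n∸m]≡n q≤w) ⟨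
        y₀ + (q + d) * b            ≡⟨ cong (y₀ +_) (*-distribʳ-+ b q d) ⟩
        y₀ + (q * b + d * b)        ≡⟨ cong (λ n → y₀ + (n + d * b)) c+r≡q*b ⟨
        y₀ + ((c + r) + d * b)      ≡⟨ shuffle r d b y₀ c ⟨
        v + c                       ∎)

    grd⁺≤grd-few-top : w < q → grd S⁺ x ≤ grd S x
    grd⁺≤grd-few-top w<q = begin
      grd S⁺ (s + c)           ≡⟨ grd-+top S⁺ s ⟩
      suc (grd S⁺ s)           ≡⟨ cong suc (grd-extend-below S c-1 (<-≤-trans s<b top≤c)) ⟩
      suc (grd S s)            ≡⟨ grd-+top S s ⟨
      grd S (s + b)            ≡⟨ cong (grd S) s+b≡y₀+r ⟩
      grd S (y₀ + r)           ≤⟨ canonical (rep-+ S (rep-grd S y₀) (rep-grd S r)) ⟩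
      grd S y₀ + grd S r       ≤⟨ +-monoʳ-≤ (grd S y₀) (≤-pred (subst (grd S r <_) q≡1+w grd-r<q)) ⟩
      grd S y₀ + w             ≡⟨ trans (+-comm (grd S y₀) w) (sym grd-x) ⟩
      grd S x                  ∎
      where
      open ≤-Reasoning
      q≡1+w : q ≡ suc w
      q≡1+w = ≤-antisym (≤-pred (*-cancelʳ-< b q (2 + w) (begin-strict
        q * b                 ≡⟨ c+r≡q*b ⟨
        c + r                 <⟨ +-mono-≤-< (m≤n+m c s) r<b ⟩
        x + b                 ≡⟨ cong (_+ b) x≡y₀+w*b ⟩
        (y₀ + w * b) + b      <⟨ +-monoˡ-< b (+-monoˡ-< (w * b) (m%n<n x b)) ⟩
        (b + w * b) + b       ≡⟨ +-comm (b + w * b) b ⟩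
        (2 + w) * b           ∎))) w<q
      s+b≡y₀+r : s + b ≡ y₀ + r
      s+b≡y₀+r = +-cancelʳ-≡ (w * b) (s + b) (y₀ + r) (begin-equality
        (s + b) + w * b       ≡⟨ +-assoc s b (w * b) ⟩
        s + (1 + w) * b       ≡⟨ cong (λ n → s + n * b) q≡1+w ⟨
        s + q * b             ≡⟨ cong (s +_) c+r≡q*b ⟨
        s + (c + r)           ≡⟨ +-assoc s c r ⟨
        x + r                 ≡⟨ cong (_+ r) x≡y₀+w*b ⟩
        (y₀ + w * b) + r      ≡⟨ +-assoc y₀ (w * b) r ⟩
        y₀ + (w * b + r)      ≡⟨ cong (y₀ +_) (+-comm (w * b) r) ⟩
        y₀ + (r + w * b)      ≡⟨ +-assoc y₀ r (w * b) ⟨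
        (y₀ + r) + w * b      ∎)
      s<b : s < b
      s<b = <-trans (+-cancelʳ-< b s r (begin-strict
        s + b                 ≡⟨ s+b≡y₀+r ⟩
        y₀ + r                <⟨ +-monoˡ-< r (m%n<n x b) ⟩
        b + r                 ≡⟨ +-comm b r ⟩
        r + b                 ∎)) r<b

    grd⁺≤grd-above : grd S⁺ s ≤ grd S s → grd S⁺ x ≤ grd S x
    grd⁺≤grd-above ih with q ≤? w
    ... | yes q≤w = grd⁺≤grd-many-top q≤w ih
    ... | no q≰w  = grd⁺≤grd-few-top (≰⇒> q≰w)

  grd⁺≤grd : ∀ x → grd S⁺ x ≤ grd S x
  grd⁺≤grd = <-rec _ step
    where
    step : ∀ x → (∀ {y} → y < x → grd S⁺ y ≤ grd S y) → grd S⁺ x ≤ grd S x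
    step x ih with x <? c
    ... | yes x<c = ≤-reflexive (grd-extend-below S c-1 x<c)
    ... | no x≮c  = subst (λ x → grd S⁺ x ≤ grd S x) (m∸n+n≡m c≤x)
                      (grd⁺≤grd-above (x ∸ c) (ih (∸-monoʳ-< z<s c≤x)))
      where c≤x = ≮⇒≥ x≮c

  canonical⁺ : Canonical S⁺
  canonical⁺ (_⊕_ {y} {m} rep z) = begin
    grd S⁺ (y + z * c)  ≡⟨ grd-+*top S⁺ y z ⟩
    z + grd S⁺ y        ≤⟨ +-monoʳ-≤ z (≤-trans (grd⁺≤grd y) (canonical rep)) ⟩
    z + m               ≡⟨ +-comm z m ⟩
    m + z               ∎
    where open ≤-Reasoning

extend-canonical : ∀ S c-1 → top S ≤ suc c-1 → Canonical S → MNTCondition S c-1 → Canonical (extend S c-1)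
extend-canonical S c-1 b≤c canonical (q , r , c+r≡q*b , r<b , grd-r<q) =
  OnePoint.canonical⁺ S c-1 b≤c canonical q r c+r≡q*b r<b grd-r<q

MultipleCounterexample : CoinSystem → ℕ → Set
MultipleCounterexample S c-1 =
  ∃ λ k → (k * top S < suc c-1) × (suc c-1 < suc k * top S) × (suc k < grd (extend S c-1) (suc k * top S))

module _ (S : CoinSystem) (c-1 : ℕ) where
  private
    b = top S
    c = suc c-1
    k = c / b

  c≡k*b⇒mntCondition : b ≤ c → c ≡ k * b → MNTCondition S c-1
  c≡k*b⇒mntCondition b≤c c≡k*b =
    k , 0 , trans (+-identityʳ c) c≡k*b , z<s , subst (_< k) (sym (grd-0 S)) (m≥n⇒m/n>0 b≤c)

  module _ (b≤c : b ≤ c) (e : ℕ) (e<b : suc e < b) (c≡e+k*b : c ≡ suc e + k * b) where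
    private
      r = b ∸ suc e

      r<b : r < b
      r<b = s≤s (m∸n≤m (pred-top S) e)

      c+r≡[1+k]*b : c + r ≡ suc k * b
      c+r≡[1+k]*b = begin
        c + r                  ≡⟨ cong (_+ r) c≡e+k*b ⟩
        (suc e + k * b) + r    ≡⟨ +-assoc (suc e) (k * b) r ⟩
        suc e + (k * b + r)    ≡⟨ cong (suc e +_) (+-comm (k * b) r) ⟩
        suc e + (r + k * b)    ≡⟨ +-assoc (suc e) r (k * b) ⟨
        (suc e + r) + k * b    ≡⟨ cong (_+ k * b) (m+[n∸m]≡n (<⇒≤ e<b)) ⟩
        b + k * b              ∎
        where open ≡-Reasoning

    mntCondition⊎multipleCounterexample-of-remainder : MNTCondition S c-1 ⊎ MultipleCounterexample S c-1
    mntCondition⊎multipleCounterexample-of-remainder with suc (grd S r) ≤? suc k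
    ... | yes grd-r<1+k = inj₁ (suc k , r , c+r≡[1+k]*b , r<b , grd-r<1+k)
    ... | no grd-r≮1+k  = inj₂ (k , k*b<c , c<[1+k]*b , subst (suc k <_) (sym grd⁺[[1+k]*b]) (≰⇒> grd-r≮1+k))
      where
      k*b<c : k * b < c
      k*b<c = subst (k * b <_) (sym c≡e+k*b) (m<n+m (k * b) z<s)
      c<[1+k]*b : c < suc k * b
      c<[1+k]*b = subst (_< suc k * b) (sym c≡e+k*b) (+-monoˡ-< (k * b) e<b)
      grd⁺[[1+k]*b] : grd (extend S c-1) (suc k * b) ≡ suc (grd S r)
      grd⁺[[1+k]*b] = begin
        grd (extend S c-1) (suc k * b)  ≡⟨ cong (grd (extend S c-1)) (trans (sym c+r≡[1+k]*b) (+-comm c r)) ⟩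
        grd (extend S c-1) (r + c)      ≡⟨ grd-+top (extend S c-1) r ⟩
        suc (grd (extend S c-1) r)      ≡⟨ cong suc (grd-extend-below S c-1 (<-≤-trans r<b b≤c)) ⟩
        suc (grd S r)                   ∎
        where open ≡-Reasoning

mntCondition⊎multipleCounterexample : ∀ S c-1 → top S ≤ suc c-1 → MNTCondition S c-1 ⊎ MultipleCounterexample S c-1
mntCondition⊎multipleCounterexample S c-1 b≤c with c % b | m≡m%n+[m/n]*n c b | m%n<n c b
  where b = top S; c = suc c-1
... | zero  | c≡k*b   | _   = inj₁ (c≡k*b⇒mntCondition S c-1 b≤c c≡k*b)
... | suc e | c≡e+k*b | e<b = mntCondition⊎multipleCounterexample-of-remainder S c-1 b≤c e e<b c≡e+k*b

module FourCoins (a-1 b-1 c-1 : ℕ) (a<b : suc a-1 < suc b-1) (b<c : suc b-1 < suc c-1) where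
  a = suc a-1
  b = suc b-1
  c = suc c-1

  ⟨1,a⟩ ⟨1,a,b⟩ ⟨1,a,b,c⟩ : CoinSystem
  ⟨1,a⟩     = extend ⟨1⟩ a-1
  ⟨1,a,b⟩   = extend ⟨1,a⟩ b-1
  ⟨1,a,b,c⟩ = extend ⟨1,a,b⟩ c-1

  size-GRD₃ : ∀ x → size (GRD (1 ∷ a ∷ b ∷ []) x) ≡ grd ⟨1,a,b⟩ x
  size-GRD₃ x = trans (cong (λ n → n + ((x % b) / a + (x / b + 0))) (n/1≡n (x % b % a)))
                      (reorder (x / b) ((x % b) / a) (x % b % a))
    where
    reorder : ∀ A B C → C + (B + (A + 0)) ≡ A + (B + C)
    reorder = solve-∀

  size-GRD₄ : ∀ x → size (GRD (1 ∷ a ∷ b ∷ c ∷ []) x) ≡ grd ⟨1,a,b,c⟩ x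
  size-GRD₄ x = trans (cong (λ n → n + ((x % c % b) / a + ((x % c) / b + (x / c + 0)))) (n/1≡n (x % c % b % a)))
                      (reorder (x / c) ((x % c) / b) ((x % c % b) / a) (x % c % b % a))
    where
    reorder : ∀ A B C D → D + (C + (B + (A + 0))) ≡ A + (B + (C + D))
    reorder = solve-∀

  rep₃ : ∀ {α x} → IsRepresentation (1 ∷ a ∷ b ∷ []) α x → Rep ⟨1,a,b⟩ x (size α)
  rep₃ {p ∷ q ∷ r ∷ []} (_ , amount) =
    subst₂ (Rep ⟨1,a,b⟩) (trans (amounts p q r) amount) (sizes p q r) ((refl ⊕ q) ⊕ r)
    where
    amounts : ∀ p q r → p + q * a + r * b ≡ p * 1 + (q * a + (r * b + 0))
    amounts = solve-∀
    sizes : ∀ p q r → p + q + r ≡ p + (q + (r + 0))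
    sizes = solve-∀

  rep₄ : ∀ {α x} → IsRepresentation (1 ∷ a ∷ b ∷ c ∷ []) α x → Rep ⟨1,a,b,c⟩ x (size α)
  rep₄ {p ∷ q ∷ r ∷ s ∷ []} (_ , amount) =
    subst₂ (Rep ⟨1,a,b,c⟩) (trans (amounts p q r s) amount) (sizes p q r s) (((refl ⊕ q) ⊕ r) ⊕ s)
    where
    amounts : ∀ p q r s → p + q * a + r * b + s * c ≡ p * 1 + (q * a + (r * b + (s * c + 0)))
    amounts = solve-∀
    sizes : ∀ p q r s → p + q + r + s ≡ p + (q + (r + (s + 0)))
    sizes = solve-∀

  Condition₂ : Set
  Condition₂ = ∃[ k ] ((k * b < c) × (c < suc k * b) × (suc k < size (GRD (1 ∷ a ∷ b ∷ c ∷ []) (suc k * b))))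

  counterexample₃ : ∀ x α → IsRepresentation (1 ∷ a ∷ b ∷ []) α x → size α < grd ⟨1,a,b⟩ x →
                    NonCanonical (1 ∷ a ∷ b ∷ [])
  counterexample₃ x α rep smaller = x , α , rep , subst (size α <_) (sym (size-GRD₃ x)) smaller

  counterexample₄ : ∀ x α → IsRepresentation (1 ∷ a ∷ b ∷ c ∷ []) α x → size α < grd ⟨1,a,b,c⟩ x →
                    NonCanonical (1 ∷ a ∷ b ∷ c ∷ [])
  counterexample₄ x α rep smaller = x , α , rep , subst (size α <_) (sym (size-GRD₄ x)) smaller

  canonical₃⇒¬nonCanonical : Canonical ⟨1,a,b⟩ → ¬ NonCanonical (1 ∷ a ∷ b ∷ [])
  canonical₃⇒¬nonCanonical canonical (x , α , rep , smaller) =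
    <⇒≱ (subst (size α <_) (size-GRD₃ x) smaller) (canonical (rep₃ {α} rep))

  canonical₄⇒¬nonCanonical : Canonical ⟨1,a,b,c⟩ → ¬ NonCanonical (1 ∷ a ∷ b ∷ c ∷ [])
  canonical₄⇒¬nonCanonical canonical (x , α , rep , smaller) =
    <⇒≱ (subst (size α <_) (size-GRD₄ x) smaller) (canonical (rep₄ {α} rep))

  ⟨1,a⟩-canonical : Canonical ⟨1,a⟩
  ⟨1,a⟩-canonical = extend-canonical ⟨1⟩ a-1 (s≤s z≤n) ⟨1⟩-canonical
                      (a , 0 , trans (+-identityʳ a) (sym (*-identityʳ a)) , z<s , z<s)

  ⟨1,a,b⟩-canonical : MNTCondition ⟨1,a⟩ b-1 → Canonical ⟨1,a,b⟩
  ⟨1,a,b⟩-canonical = extend-canonical ⟨1,a⟩ b-1 (<⇒≤ a<b) ⟨1,a⟩-canonical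

  ⟨1,a,b,c⟩-canonical : MNTCondition ⟨1,a⟩ b-1 → MNTCondition ⟨1,a,b⟩ c-1 → Canonical ⟨1,a,b,c⟩
  ⟨1,a,b,c⟩-canonical mnt₃ = extend-canonical ⟨1,a,b⟩ c-1 (<⇒≤ b<c) (⟨1,a,b⟩-canonical mnt₃)

  multipleCounterexample₃⇒nonCanonical₃ : MultipleCounterexample ⟨1,a⟩ b-1 → NonCanonical (1 ∷ a ∷ b ∷ [])
  multipleCounterexample₃⇒nonCanonical₃ (k , _ , _ , smaller) =
    counterexample₃ (suc k * a) (0 ∷ suc k ∷ 0 ∷ []) (refl , +-identityʳ (suc k * a))
                    (subst (_< grd ⟨1,a,b⟩ (suc k * a)) (sym (+-identityʳ (suc k))) smaller)

  multipleCounterexample₄⇒condition₂ : MultipleCounterexample ⟨1,a,b⟩ c-1 → Condition₂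
  multipleCounterexample₄⇒condition₂ (k , k*b<c , c<[1+k]*b , smaller) =
    k , k*b<c , c<[1+k]*b , subst (suc k <_) (sym (size-GRD₄ (suc k * b))) smaller

  condition₂⇒nonCanonical₄ : Condition₂ → NonCanonical (1 ∷ a ∷ b ∷ c ∷ [])
  condition₂⇒nonCanonical₄ (k , _ , _ , smaller) =
    suc k * b , (0 ∷ 0 ∷ suc k ∷ 0 ∷ []) , (refl , +-identityʳ (suc k * b)) ,
    subst (_< size (GRD (1 ∷ a ∷ b ∷ c ∷ []) (suc k * b))) (sym (+-identityʳ (suc k))) smaller

  nonCanonical₄⇒ : NonCanonical (1 ∷ a ∷ b ∷ c ∷ []) → NonCanonical (1 ∷ a ∷ b ∷ []) ⊎ Condition₂
  nonCanonical₄⇒ nc₄ with mntCondition⊎multipleCounterexample ⟨1,a,b⟩ c-1 (<⇒≤ b<c)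
  ... | inj₂ mc₄  = inj₂ (multipleCounterexample₄⇒condition₂ mc₄)
  ... | inj₁ mnt₄ with mntCondition⊎multipleCounterexample ⟨1,a⟩ b-1 (<⇒≤ a<b)
  ...   | inj₂ mc₃  = inj₁ (multipleCounterexample₃⇒nonCanonical₃ mc₃)
  ...   | inj₁ mnt₃ = ⊥-elim (canonical₄⇒¬nonCanonical (⟨1,a,b,c⟩-canonical mnt₃ mnt₄) nc₄)

  grd₃-below-a : ∀ {d} → d < a → grd ⟨1,a,b⟩ d ≡ d
  grd₃-below-a d<a = trans (grd-extend-below ⟨1,a⟩ b-1 (<-trans d<a a<b)) (grd-extend-below ⟨1⟩ a-1 d<a)

  grd₄-below-a+c : ∀ {d} → d < a → grd ⟨1,a,b,c⟩ (d + c) ≡ suc d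
  grd₄-below-a+c {d} d<a = trans (grd-+top ⟨1,a,b,c⟩ d)
    (cong suc (trans (grd-extend-below ⟨1,a,b⟩ c-1 (<-trans (<-trans d<a a<b) b<c)) (grd₃-below-a d<a)))

  counterexample-a+b : 2 + c ≤ a + b → NonCanonical (1 ∷ a ∷ b ∷ c ∷ [])
  counterexample-a+b 2+c≤a+b = counterexample₄ (a + b) (0 ∷ 1 ∷ 1 ∷ 0 ∷ []) (refl , amount a b c) 2<grd
    where
    amount : ∀ a b c → 0 * 1 + (1 * a + (1 * b + (0 * c + 0))) ≡ a + b
    amount = solve-∀
    d = a + b ∸ c
    d+c≡a+b : d + c ≡ a + b
    d+c≡a+b = m∸n+n≡m (≤-trans (n≤1+n c) (≤-pred (≤-trans (n≤1+n (2 + c)) (s≤s 2+c≤a+b))))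
    d<a : d < a
    d<a = +-cancelʳ-< c d a (subst (_< a + c) (sym d+c≡a+b) (+-monoʳ-< a b<c))
    2≤d : 2 ≤ d
    2≤d = +-cancelʳ-≤ c 2 d (subst (2 + c ≤_) (sym d+c≡a+b) 2+c≤a+b)
    2<grd : 2 < grd ⟨1,a,b,c⟩ (a + b)
    2<grd = subst (2 <_) (trans (sym (grd₄-below-a+c d<a)) (cong (grd ⟨1,a,b,c⟩) d+c≡a+b)) (s≤s 2≤d)

  multipleCounterexample₃⇒b+1≢a+a : 1 < a → MultipleCounterexample ⟨1,a⟩ b-1 → suc b ≢ a + a
  multipleCounterexample₃⇒b+1≢a+a _ (zero , _ , b<a+0 , _) _ =
    <-asym a<b (subst (b <_) (+-identityʳ a) b<a+0)
  multipleCounterexample₃⇒b+1≢a+a 1<a (1 , _ , _ , 2<grd) b+1≡a+a = <-irrefl refl (begin-strict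
    2                                  <⟨ 2<grd ⟩
    grd ⟨1,a,b⟩ (a + (a + 0))          ≡⟨ cong (grd ⟨1,a,b⟩) (trans (cong (a +_) (+-identityʳ a)) (sym b+1≡a+a)) ⟩
    grd ⟨1,a,b⟩ (1 + b)                ≡⟨ grd-+top ⟨1,a,b⟩ 1 ⟩
    suc (grd ⟨1,a,b⟩ 1)                ≡⟨ cong suc (grd₃-below-a 1<a) ⟩
    2                                  ∎)
    where open ≤-Reasoning
  multipleCounterexample₃⇒b+1≢a+a _ (suc (suc k) , [2+k]*a<b , _ , _) b+1≡a+a =
    <⇒≱ [2+k]*a<b (begin
      b                  ≤⟨ n≤1+n b ⟩
      suc b              ≡⟨ b+1≡a+a ⟩
      a + a              ≤⟨ +-monoʳ-≤ a (m≤m+n a (k * a)) ⟩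
      a + (a + k * a)    ∎)
    where open ≤-Reasoning

  condition₂-of-c+1≡a+b : 1 < a → suc c ≡ a + b → suc b ≢ a + a → Condition₂
  condition₂-of-c+1≡a+b 1<a c+1≡a+b b+1≢a+a =
    1 , subst (_< c) (sym (+-identityʳ b)) b<c , c<2*b ,
    subst (2 <_) (sym (trans (size-GRD₄ (2 * b)) grd₄[2*b])) (s≤s 2≤grd₂v)
    where
    open ≡-Reasoning
    c<2*b : c < 2 * b
    c<2*b = subst (c <_) (cong (b +_) (sym (+-identityʳ b)))
                  (<-trans (n<1+n c) (subst (_< b + b) (sym c+1≡a+b) (+-monoˡ-< b a<b)))
    v = suc (b ∸ a)
    v<b : v < b
    v<b = s≤s (∸-monoʳ-< 1<a (<⇒≤ a<b))
    v+c≡2*b : v + c ≡ 2 * b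
    v+c≡2*b = begin
      suc (b ∸ a) + c     ≡⟨ +-suc (b ∸ a) c ⟨
      b ∸ a + suc c       ≡⟨ cong (b ∸ a +_) c+1≡a+b ⟩
      b ∸ a + (a + b)     ≡⟨ +-assoc (b ∸ a) a b ⟨
      b ∸ a + a + b       ≡⟨ cong (_+ b) (m∸n+n≡m (<⇒≤ a<b)) ⟩
      b + b               ≡⟨ cong (b +_) (+-identityʳ b) ⟨
      2 * b               ∎
    grd₄[2*b] : grd ⟨1,a,b,c⟩ (2 * b) ≡ suc (v / a + v % a)
    grd₄[2*b] = begin
      grd ⟨1,a,b,c⟩ (2 * b)  ≡⟨ cong (grd ⟨1,a,b,c⟩) v+c≡2*b ⟨
      grd ⟨1,a,b,c⟩ (v + c)  ≡⟨ grd-+top ⟨1,a,b,c⟩ v ⟩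
      suc (grd ⟨1,a,b,c⟩ v)  ≡⟨ cong suc (grd-extend-below ⟨1,a,b⟩ c-1 (<-trans v<b b<c)) ⟩
      suc (grd ⟨1,a,b⟩ v)    ≡⟨ cong suc (grd-extend-below ⟨1,a⟩ b-1 v<b) ⟩
      suc (v / a + v % a)    ∎
    b+1≡v+a : suc b ≡ v + a
    b+1≡v+a = cong suc (sym (m∸n+n≡m (<⇒≤ a<b)))
    2≤grd₂v : 2 ≤ v / a + v % a
    2≤grd₂v with 2 ≤? v / a + v % a
    ... | yes 2≤ = 2≤
    ... | no 2≰ = ⊥-elim (b+1≢a+a (trans b+1≡v+a (cong (_+ a)
                    (m/n+m%n≤1⇒m≡n v a (s≤s (m<n⇒0<n∸m a<b)) (≤-pred (≰⇒> 2≰))))))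

  multipleCounterexample₃⇒nonCanonical₄ : 1 < a → MultipleCounterexample ⟨1,a⟩ b-1 → NonCanonical (1 ∷ a ∷ b ∷ c ∷ [])
  multipleCounterexample₃⇒nonCanonical₄ 1<a mc₃@(k , k*a<b , _ , smaller) with suc k * a <? c
  ... | yes x₀<c = counterexample₄ (suc k * a) (0 ∷ suc k ∷ 0 ∷ 0 ∷ []) (refl , +-identityʳ (suc k * a))
                     (subst₂ _<_ (sym (+-identityʳ (suc k))) (sym (grd-extend-below ⟨1,a,b⟩ c-1 x₀<c)) smaller)
  ... | no x₀≮c with 2 + c ≤? a + b
  ...   | yes 2+c≤a+b = counterexample-a+b 2+c≤a+b
  ...   | no 2+c≰a+b  = condition₂⇒nonCanonical₄
                          (condition₂-of-c+1≡a+b 1<a c+1≡a+b (multipleCounterexample₃⇒b+1≢a+a 1<a mc₃))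
    where
    c+1≡a+b : suc c ≡ a + b
    c+1≡a+b = ≤-antisym (≤-<-trans (≮⇒≥ x₀≮c) (+-monoʳ-< a k*a<b)) (≤-pred (≰⇒> 2+c≰a+b))

  ⇒nonCanonical₄ : 1 < a → NonCanonical (1 ∷ a ∷ b ∷ []) ⊎ Condition₂ → NonCanonical (1 ∷ a ∷ b ∷ c ∷ [])
  ⇒nonCanonical₄ _   (inj₂ cond₂) = condition₂⇒nonCanonical₄ cond₂
  ⇒nonCanonical₄ 1<a (inj₁ nc₃) with mntCondition⊎multipleCounterexample ⟨1,a⟩ b-1 (<⇒≤ a<b)
  ... | inj₁ mnt₃ = ⊥-elim (canonical₃⇒¬nonCanonical (⟨1,a,b⟩-canonical mnt₃) nc₃)
  ... | inj₂ mc₃  = multipleCounterexample₃⇒nonCanonical₄ 1<a mc₃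

theorem6 : (c₂ c₃ c₄ : ℕ) → 1 < c₂ → c₂ < c₃ → c₃ < c₄ →
    NonCanonical (1 ∷ c₂ ∷ c₃ ∷ c₄ ∷ [])
      ⇔ (NonCanonical (1 ∷ c₂ ∷ c₃ ∷ [])
         ⊎ (∃[ k ] ((k * c₃ < c₄) × (c₄ < suc k * c₃)
                    × (suc k < size (GRD (1 ∷ c₂ ∷ c₃ ∷ c₄ ∷ []) (suc k * c₃))))))
theorem6 (suc a-1) (suc b-1) (suc c-1) 1<a a<b b<c = mk⇔ nonCanonical₄⇒ (⇒nonCanonical₄ 1<a)
  where open FourCoins a-1 b-1 c-1 a<b b<c
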